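{- There is a partial order $(P,\leq_P)$, with first, second and third levels $P_1,P_2,P_3$, such that: (1) $P$ is locally countable, has size continuum and has height three; (2) $P_1$ has size continuum; (3) every countable subset of $P_1$ has an upper bound in $P_2$; (4) for every finite subset $Q$ of $P_1 \cup P_2$ and every $q \in P_2$ not equal to any element of $Q$, there is an element of $P_3$ which is above every element of $Q$ but not above $q$.
   Context: A partial order is locally countable if every element has only countably many strict predecessors; it has height $n$ if its longest chain has exactly $n$ elements. In a partial order of height three, the first level consists of elements with no strict predecessors, the second level of elements not in the first level all of whose strict predecessors are in the first level, and the third level of the remaining elements. -}

module Defs where

open import Level using (0ℓ)
open import Data.Nat using (ℕ)
open import Data.Bool using (Bool)
open import Data.Maybe using (Maybe; just)
open import Data.Unit using (⊤)
open import Data.Empty using (⊥)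
open import Data.Sum using (_⊎_)
open import Data.Product using (Σ; ∃; ∃-syntax; _×_; _,_)
open import Data.List using (List)
open import Data.List.Relation.Unary.All using (All)
open import Relation.Nullary using (¬_)
open import Relation.Binary.PropositionalEquality using (_≡_)
open import Relation.Binary.Bundles using (Poset)

-- Cantor space 2^ℕ, with pointwise (extensional) equality; its cardinality is the continuum.
Cantor : Set
Cantor = ℕ → Bool

_≗ᶜ_ : Cantor → Cantor → Set
α ≗ᶜ β = ∀ n → α n ≡ β n

module PosetNotions (P : Poset 0ℓ 0ℓ 0ℓ) where
  open Poset P

  _<_ : Carrier → Carrier → Set
  x < y = x ≤ y × ¬ (x ≈ y)

  -- a subset S (given as a predicate) is countable: there is a map ℕ → Maybe Carrier
  -- whose (just-)values lie in S and hit every element of S (up to ≈).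
  -- The Maybe allows the empty subset.
  Countable : (Carrier → Set) → Set
  Countable S = Σ (ℕ → Maybe Carrier) λ f →
      (∀ n a → f n ≡ just a → S a)
    × (∀ a → S a → ∃[ n ] ∃[ b ] (f n ≡ just b × b ≈ a))

  SizeContinuum : (Carrier → Set) → Set
  SizeContinuum S = Σ (Cantor → Carrier) λ f →
      (∀ α → S (f α))
    × (∀ α β → α ≗ᶜ β → f α ≈ f β)
    × (∀ α β → f α ≈ f β → α ≗ᶜ β)
    × (∀ x → S x → ∃[ α ] (f α ≈ x))

  LocallyCountable : Set
  LocallyCountable = ∀ x → Countable (λ y → y < x)

  HeightThree : Set
  HeightThree =
      (∃[ x ] ∃[ y ] ∃[ z ] (x < y × y < z))
    × (∀ x y z w → x < y → y < z → z < w → ⊥)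

  Level1 : Carrier → Set
  Level1 x = ∀ y → ¬ (y < x)

  Level2 : Carrier → Set
  Level2 x = ¬ Level1 x × (∀ y → y < x → Level1 y)

  Level3 : Carrier → Set
  Level3 x = ¬ Level1 x × ¬ Level2 x

  Lemma3p2Props : Set₁
  Lemma3p2Props =
      (LocallyCountable × SizeContinuum (λ _ → ⊤) × HeightThree)
    × SizeContinuum Level1
    × (∀ (S : Carrier → Set) → (∀ x → S x → Level1 x) → Countable S →
         ∃[ u ] (Level2 u × (∀ x → S x → x ≤ u)))
    × (∀ (Q : List Carrier) → All (λ x → Level1 x ⊎ Level2 x) Q →
         ∀ q → Level2 q → All (λ x → ¬ (q ≈ x)) Q →
         ∃[ r ] (Level3 r × All (λ x → x ≤ r) Q × ¬ (q ≤ r)))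

-- Elements of P are points of three kinds, each carrying a point of Cantor space that,
-- read as a code for a sequence of points of Cantor space, lists the predecessors:
-- low α is minimal, mid β lies above the lows listed by β, and high γ lies above the
-- mids listed by γ and above everything below those. Every element then has countably
-- many predecessors, a countable set of lows is listed by a single mid, and a finite set
-- of lows and mids sits below a high whose list avoids any prescribed other mid.
module Submission where

open import Defs
open import Level using (0ℓ)
open import Function using (_∘_)
open import Data.Bool using (Bool; true; false; not)
open import Data.Bool.Properties using (not-¬)
open import Data.Nat using (ℕ; zero; suc; _+_)
open import Data.Nat.Properties using (+-suc; +-identityʳ)
open import Data.Product using (Σ; ∃-syntax; _×_; _,_; uncurry′)
open import Data.Sum using (_⊎_; inj₁; inj₂; [_,_]; map₂)
open import Data.Maybe using (Maybe; just; nothing; maybe′)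
open import Data.List using (List; []; _∷_; map)
open import Data.List.Membership.Propositional using (_∈_)
open import Data.List.Membership.Propositional.Properties using (∈-map⁺; ∈-map⁻)
open import Data.List.Relation.Unary.Any using (here; there)
open import Data.List.Relation.Unary.All as All using (All)
open import Data.Empty using (⊥-elim)
open import Data.Unit using (⊤; tt)
open import Relation.Nullary using (¬_)
open import Relation.Binary.Bundles using (Poset; Setoid)
open import Relation.Binary.PropositionalEquality
  using (_≡_; refl; sym; trans; cong; subst; _→-setoid_)
import Relation.Binary.Reasoning.Setoid as SetoidReasoning

open Setoid (ℕ →-setoid Bool) using ()
  renaming (refl to ≗ᶜ-refl; sym to ≗ᶜ-sym; trans to ≗ᶜ-trans)
open SetoidReasoning (ℕ →-setoid Bool)

-- unpair enumerates ℕ × ℕ along the antidiagonals (0,0), (0,1), (1,0), (0,2), (1,1), (2,0), …,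
-- so (i , j) comes at position triangle (i + j) + i.
unpair : ℕ → ℕ × ℕ
unpair zero = 0 , 0
unpair (suc n) = next (unpair n)
  where
  next : ℕ × ℕ → ℕ × ℕ
  next (i , zero) = 0 , suc i
  next (i , suc j) = suc i , j

triangle : ℕ → ℕ
triangle zero = zero
triangle (suc d) = suc (triangle d + d)

pair : ℕ → ℕ → ℕ
pair i j = triangle (i + j) + i

unpair-triangle+ : ∀ d i j → i + j ≡ d → unpair (triangle d + i) ≡ (i , j)
unpair-triangle+ zero zero zero refl = refl
unpair-triangle+ (suc d) zero .(suc d) refl
  rewrite +-identityʳ (triangle d + d) | unpair-triangle+ d d 0 (+-identityʳ d) = refl
unpair-triangle+ d (suc i) j i+j≡d
  rewrite +-suc (triangle d) i | unpair-triangle+ d i (suc j) (trans (+-suc i j) i+j≡d) = refl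

unpair-pair : ∀ i j → unpair (pair i j) ≡ (i , j)
unpair-pair i j = unpair-triangle+ (i + j) i j refl

decode : Cantor → ℕ → Cantor
decode γ i j = γ (pair i j)

encode : (ℕ → Cantor) → Cantor
encode s n = uncurry′ s (unpair n)

decode-encode : ∀ s i → decode (encode s) i ≗ᶜ s i
decode-encode s i j = cong (uncurry′ s) (unpair-pair i j)

decode-cong : ∀ {γ δ} → γ ≗ᶜ δ → ∀ i → decode γ i ≗ᶜ decode δ i
decode-cong γ≗δ i j = γ≗δ (pair i j)

record _∈ᶜ_ (α γ : Cantor) : Set where
  constructor _,_
  field
    index : ℕ
    entry : α ≗ᶜ decode γ index

decode-∈ᶜ : ∀ γ i → decode γ i ∈ᶜ γ
decode-∈ᶜ γ i = i , ≗ᶜ-refl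

∈ᶜ-encode : ∀ s i → s i ∈ᶜ encode s
∈ᶜ-encode s i = i , ≗ᶜ-sym (decode-encode s i)

∈ᶜ-respˡ : ∀ {α β γ} → α ≗ᶜ β → β ∈ᶜ γ → α ∈ᶜ γ
∈ᶜ-respˡ α≗β (i , β≗γᵢ) = i , ≗ᶜ-trans α≗β β≗γᵢ

∈ᶜ-respʳ : ∀ {α γ δ} → α ∈ᶜ γ → γ ≗ᶜ δ → α ∈ᶜ δ
∈ᶜ-respʳ (i , α≗γᵢ) γ≗δ = i , ≗ᶜ-trans α≗γᵢ (decode-cong γ≗δ i)

complement : Cantor → Cantor
complement α n = not (α n)

≗ᶜ-complement-absurd : ∀ {α} → ¬ (α ≗ᶜ complement α)
≗ᶜ-complement-absurd α≗ᾱ = not-¬ refl (α≗ᾱ 0)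

infixr 25 _∷ᶜ_

_∷ᶜ_ : Bool → Cantor → Cantor
(b ∷ᶜ α) zero = b
(b ∷ᶜ α) (suc n) = α n

tailᶜ : Cantor → Cantor
tailᶜ α n = α (suc n)

∷ᶜ-cong : ∀ b {α β} → α ≗ᶜ β → b ∷ᶜ α ≗ᶜ b ∷ᶜ β
∷ᶜ-cong b α≗β zero = refl
∷ᶜ-cong b α≗β (suc n) = α≗β n

pad : {A : Set} → A → List A → ℕ → A
pad d [] _ = d
pad d (x ∷ xs) zero = x
pad d (x ∷ xs) (suc n) = pad d xs n

pad-complete : ∀ {A : Set} (d : A) {xs x} → x ∈ xs → ∃[ n ] (pad d xs n ≡ x)
pad-complete d (here refl) = 0 , refl
pad-complete d (there x∈xs) = let n , padₙ≡x = pad-complete d x∈xs in suc n , padₙ≡x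

pad-sound : ∀ {A : Set} (d : A) xs n → pad d xs n ≡ d ⊎ pad d xs n ∈ xs
pad-sound d [] n = inj₁ refl
pad-sound d (x ∷ xs) zero = inj₂ (here refl)
pad-sound d (x ∷ xs) (suc n) = map₂ there (pad-sound d xs n)

data Point : Set where
  low mid high : Cantor → Point

label : Point → Cantor
label (low α) = α
label (mid β) = β
label (high γ) = γ

data _≈ᵖ_ : Point → Point → Set where
  low : ∀ {α α′} → α ≗ᶜ α′ → low α ≈ᵖ low α′
  mid : ∀ {β β′} → β ≗ᶜ β′ → mid β ≈ᵖ mid β′
  high : ∀ {γ γ′} → γ ≗ᶜ γ′ → high γ ≈ᵖ high γ′

data _⋖_ : Point → Point → Set where
  low⋖mid : ∀ {α β} → α ∈ᶜ β → low α ⋖ mid β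
  mid⋖high : ∀ {β γ} → β ∈ᶜ γ → mid β ⋖ high γ
  low⋖high : ∀ {α β γ} → α ∈ᶜ β → β ∈ᶜ γ → low α ⋖ high γ

_≤ᵖ_ : Point → Point → Set
x ≤ᵖ y = x ≈ᵖ y ⊎ x ⋖ y

≈ᵖ-refl : ∀ {x} → x ≈ᵖ x
≈ᵖ-refl {low _} = low ≗ᶜ-refl
≈ᵖ-refl {mid _} = mid ≗ᶜ-refl
≈ᵖ-refl {high _} = high ≗ᶜ-refl

≈ᵖ-sym : ∀ {x y} → x ≈ᵖ y → y ≈ᵖ x
≈ᵖ-sym (low e) = low (≗ᶜ-sym e)
≈ᵖ-sym (mid e) = mid (≗ᶜ-sym e)
≈ᵖ-sym (high e) = high (≗ᶜ-sym e)

≈ᵖ-trans : ∀ {x y z} → x ≈ᵖ y → y ≈ᵖ z → x ≈ᵖ z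
≈ᵖ-trans (low e) (low e′) = low (≗ᶜ-trans e e′)
≈ᵖ-trans (mid e) (mid e′) = mid (≗ᶜ-trans e e′)
≈ᵖ-trans (high e) (high e′) = high (≗ᶜ-trans e e′)

label-cong : ∀ {x y} → x ≈ᵖ y → label x ≗ᶜ label y
label-cong (low e) = e
label-cong (mid e) = e
label-cong (high e) = e

⋖-respˡ : ∀ {x y z} → x ≈ᵖ y → y ⋖ z → x ⋖ z
⋖-respˡ (low e) (low⋖mid p) = low⋖mid (∈ᶜ-respˡ e p)
⋖-respˡ (low e) (low⋖high p q) = low⋖high (∈ᶜ-respˡ e p) q
⋖-respˡ (mid e) (mid⋖high q) = mid⋖high (∈ᶜ-respˡ e q)

⋖-respʳ : ∀ {x y z} → x ⋖ y → y ≈ᵖ z → x ⋖ z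
⋖-respʳ (low⋖mid p) (mid e) = low⋖mid (∈ᶜ-respʳ p e)
⋖-respʳ (low⋖high p q) (high e) = low⋖high p (∈ᶜ-respʳ q e)
⋖-respʳ (mid⋖high q) (high e) = mid⋖high (∈ᶜ-respʳ q e)

⋖-trans : ∀ {x y z} → x ⋖ y → y ⋖ z → x ⋖ z
⋖-trans (low⋖mid p) (mid⋖high q) = low⋖high p q
⋖-trans (mid⋖high _) ()
⋖-trans (low⋖high _ _) ()

⋖-asym : ∀ {x y} → x ⋖ y → ¬ (y ⋖ x)
⋖-asym (low⋖mid _) ()
⋖-asym (mid⋖high _) ()
⋖-asym (low⋖high _ _) ()

⋖⇒≉ : ∀ {x y} → x ⋖ y → ¬ (x ≈ᵖ y)
⋖⇒≉ (low⋖mid _) ()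
⋖⇒≉ (mid⋖high _) ()
⋖⇒≉ (low⋖high _ _) ()

no-⋖-chain₄ : ∀ {x y z w} → x ⋖ y → y ⋖ z → ¬ (z ⋖ w)
no-⋖-chain₄ (low⋖mid _) (mid⋖high _) ()
no-⋖-chain₄ (mid⋖high _) ()
no-⋖-chain₄ (low⋖high _ _) ()

≤ᵖ-trans : ∀ {x y z} → x ≤ᵖ y → y ≤ᵖ z → x ≤ᵖ z
≤ᵖ-trans (inj₁ e) (inj₁ e′) = inj₁ (≈ᵖ-trans e e′)
≤ᵖ-trans (inj₁ e) (inj₂ l) = inj₂ (⋖-respˡ e l)
≤ᵖ-trans (inj₂ l) (inj₁ e) = inj₂ (⋖-respʳ l e)
≤ᵖ-trans (inj₂ l) (inj₂ l′) = inj₂ (⋖-trans l l′)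

≤ᵖ-antisym : ∀ {x y} → x ≤ᵖ y → y ≤ᵖ x → x ≈ᵖ y
≤ᵖ-antisym (inj₁ e) _ = e
≤ᵖ-antisym (inj₂ _) (inj₁ e) = ≈ᵖ-sym e
≤ᵖ-antisym (inj₂ l) (inj₂ l′) = ⊥-elim (⋖-asym l l′)

P : Poset 0ℓ 0ℓ 0ℓ
P = record
  { Carrier = Point
  ; _≈_ = _≈ᵖ_
  ; _≤_ = _≤ᵖ_
  ; isPartialOrder = record
    { isPreorder = record
      { isEquivalence = record { refl = ≈ᵖ-refl ; sym = ≈ᵖ-sym ; trans = ≈ᵖ-trans }
      ; reflexive = inj₁
      ; trans = ≤ᵖ-trans
      }
    ; antisym = ≤ᵖ-antisym
    }
  }

open PosetNotions P

<⇒⋖ : ∀ {x y} → x < y → x ⋖ y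
<⇒⋖ (inj₁ e , x≉y) = ⊥-elim (x≉y e)
<⇒⋖ (inj₂ l , _) = l

⋖⇒< : ∀ {x y} → x ⋖ y → x < y
⋖⇒< l = inj₂ l , ⋖⇒≉ l

Level1-low : ∀ {α} → Level1 (low α)
Level1-low y y<low with <⇒⋖ y<low
... | ()

⋖⇒¬Level1 : ∀ {x y} → x ⋖ y → ¬ Level1 y
⋖⇒¬Level1 {x} x⋖y y-minimal = y-minimal x (⋖⇒< x⋖y)

¬Level1-mid : ∀ {β} → ¬ Level1 (mid β)
¬Level1-mid {β} = ⋖⇒¬Level1 (low⋖mid (decode-∈ᶜ β 0))

¬Level1-high : ∀ {γ} → ¬ Level1 (high γ)
¬Level1-high {γ} = ⋖⇒¬Level1 (mid⋖high (decode-∈ᶜ γ 0))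

Level2-mid : ∀ {β} → Level2 (mid β)
Level2-mid = ¬Level1-mid , λ y y<mid → below-mid (<⇒⋖ y<mid)
  where
  below-mid : ∀ {y β} → y ⋖ mid β → Level1 y
  below-mid (low⋖mid _) = Level1-low

¬Level2-low : ∀ {α} → ¬ Level2 (low α)
¬Level2-low (¬low-minimal , _) = ¬low-minimal Level1-low

¬Level2-high : ∀ {γ} → ¬ Level2 (high γ)
¬Level2-high {γ} (_ , below-minimal) =
  ¬Level1-mid (below-minimal (mid (decode γ 0)) (⋖⇒< (mid⋖high (decode-∈ᶜ γ 0))))

Level3-high : ∀ {γ} → Level3 (high γ)
Level3-high = ¬Level1-high , ¬Level2-high

below-high : Cantor → ℕ × ℕ → Point
below-high γ (j , zero) = mid (decode γ j)
below-high γ (j , suc i) = low (decode (decode γ j) i)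

below-high-⋖ : ∀ γ p → below-high γ p ⋖ high γ
below-high-⋖ γ (j , zero) = mid⋖high (decode-∈ᶜ γ j)
below-high-⋖ γ (j , suc i) = low⋖high (decode-∈ᶜ (decode γ j) i) (decode-∈ᶜ γ j)

predecessors : Point → ℕ → Maybe Point
predecessors (low _) _ = nothing
predecessors (mid β) n = just (low (decode β n))
predecessors (high γ) n = just (below-high γ (unpair n))

predecessors-⋖ : ∀ x n {y} → predecessors x n ≡ just y → y ⋖ x
predecessors-⋖ (low _) n ()
predecessors-⋖ (mid β) n refl = low⋖mid (decode-∈ᶜ β n)
predecessors-⋖ (high γ) n refl = below-high-⋖ γ (unpair n)

⋖⇒predecessor : ∀ {y x} → y ⋖ x → ∃[ n ] ∃[ z ] (predecessors x n ≡ just z × z ≈ᵖ y)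
⋖⇒predecessor (low⋖mid (i , α≗βᵢ)) = i , _ , refl , low (≗ᶜ-sym α≗βᵢ)
⋖⇒predecessor {x = high γ} (mid⋖high (j , β≗γⱼ)) =
  pair j 0 , _ , cong (just ∘ below-high γ) (unpair-pair j 0) , mid (≗ᶜ-sym β≗γⱼ)
⋖⇒predecessor {x = high γ} (low⋖high (i , α≗βᵢ) (j , β≗γⱼ)) =
  pair j (suc i) , _ , cong (just ∘ below-high γ) (unpair-pair j (suc i)) ,
  low (≗ᶜ-sym (≗ᶜ-trans α≗βᵢ (decode-cong β≗γⱼ i)))

locally-countable : LocallyCountable
locally-countable x =
  predecessors x ,
  (λ n y eq → ⋖⇒< (predecessors-⋖ x n eq)) ,
  (λ y y<x → ⋖⇒predecessor (<⇒⋖ y<x))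

height-three : HeightThree
height-three =
  (low (decode (decode γ 0) 0) , mid (decode γ 0) , high γ ,
   ⋖⇒< (low⋖mid (decode-∈ᶜ (decode γ 0) 0)) , ⋖⇒< (mid⋖high (decode-∈ᶜ γ 0))) ,
  λ x y z w x<y y<z z<w → no-⋖-chain₄ (<⇒⋖ x<y) (<⇒⋖ y<z) (<⇒⋖ z<w)
  where
  γ : Cantor
  γ _ = false

shape : Bool → Bool → Cantor → Point
shape false _ α = low α
shape true false α = mid (tailᶜ α)
shape true true α = high (tailᶜ α)

toPoint : Cantor → Point
toPoint α = shape (α 0) (α 1) (tailᶜ α)

fromPoint : Point → Cantor
fromPoint (low α) = false ∷ᶜ α
fromPoint (mid β) = true ∷ᶜ false ∷ᶜ β
fromPoint (high γ) = true ∷ᶜ true ∷ᶜ γ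

shape-cong : ∀ b c {α β} → α ≗ᶜ β → shape b c α ≈ᵖ shape b c β
shape-cong false _ α≗β = low α≗β
shape-cong true false α≗β = mid (α≗β ∘ suc)
shape-cong true true α≗β = high (α≗β ∘ suc)

toPoint-cong : ∀ {α β} → α ≗ᶜ β → toPoint α ≈ᵖ toPoint β
toPoint-cong {α} {β} α≗β rewrite α≗β 0 | α≗β 1 = shape-cong (β 0) (β 1) (α≗β ∘ suc)

fromPoint-cong : ∀ {x y} → x ≈ᵖ y → fromPoint x ≗ᶜ fromPoint y
fromPoint-cong (low e) = ∷ᶜ-cong false e
fromPoint-cong (mid e) = ∷ᶜ-cong true (∷ᶜ-cong false e)
fromPoint-cong (high e) = ∷ᶜ-cong true (∷ᶜ-cong true e)

toPoint-fromPoint : ∀ x → toPoint (fromPoint x) ≈ᵖ x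
toPoint-fromPoint (low _) = ≈ᵖ-refl
toPoint-fromPoint (mid _) = ≈ᵖ-refl
toPoint-fromPoint (high _) = ≈ᵖ-refl

fromPoint-toPoint : ∀ α → fromPoint (toPoint α) ≗ᶜ α
fromPoint-toPoint α with α 0 in α₀ | α 1 in α₁
... | false | _ = λ { zero → sym α₀ ; (suc n) → refl }
... | true | false = λ { zero → sym α₀ ; (suc zero) → sym α₁ ; (suc (suc n)) → refl }
... | true | true = λ { zero → sym α₀ ; (suc zero) → sym α₁ ; (suc (suc n)) → refl }

continuum : SizeContinuum (λ _ → ⊤)
continuum =
  toPoint ,
  (λ _ → tt) ,
  (λ _ _ → toPoint-cong) ,
  (λ α β eq → begin
     α                     ≈⟨ fromPoint-toPoint α ⟨
     fromPoint (toPoint α) ≈⟨ fromPoint-cong eq ⟩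
     fromPoint (toPoint β) ≈⟨ fromPoint-toPoint β ⟩
     β                     ∎) ,
  (λ x _ → fromPoint x , toPoint-fromPoint x)

Level1-continuum : SizeContinuum Level1
Level1-continuum = low , (λ _ → Level1-low) , (λ _ _ → low) , (λ { _ _ (low e) → e }) , lows
  where
  lows : ∀ x → Level1 x → ∃[ α ] (low α ≈ᵖ x)
  lows (low α) _ = α , ≈ᵖ-refl
  lows (mid _) x-minimal = ⊥-elim (¬Level1-mid x-minimal)
  lows (high _) x-minimal = ⊥-elim (¬Level1-high x-minimal)

countable-upper-bound : ∀ (S : Point → Set) → (∀ x → S x → Level1 x) → Countable S →
                        ∃[ u ] (Level2 u × (∀ x → S x → x ≤ᵖ u))
countable-upper-bound S S⊆Level1 (f , _ , f-onto) = mid (encode labels) , Level2-mid , bound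
  where
  labels : ℕ → Cantor
  labels n = maybe′ label (λ _ → false) (f n)

  listed : ∀ {α} → ∃[ n ] ∃[ z ] (f n ≡ just z × z ≈ᵖ low α) → α ∈ᶜ encode labels
  listed {α} (n , z , fn≡z , z≈α) = n , (begin
    α                  ≈⟨ label-cong z≈α ⟨
    label z            ≡⟨ cong (maybe′ label (λ _ → false)) fn≡z ⟨
    labels n           ≈⟨ decode-encode labels n ⟨
    decode (encode labels) n ∎)

  bound : ∀ x → S x → x ≤ᵖ mid (encode labels)
  bound (low α) Sα = inj₂ (low⋖mid (listed (f-onto (low α) Sα)))
  bound (mid _) Sx = ⊥-elim (¬Level1-mid (S⊆Level1 _ Sx))
  bound (high _) Sx = ⊥-elim (¬Level1-high (S⊆Level1 _ Sx))

module Avoiding (β : Cantor) where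

  -- cover x is the code of a mid above x, chosen different from β unless x ≈ᵖ mid β:
  -- the mid above low α lists α after an entry differing from the first entry of β.
  guarded : Cantor → ℕ → Cantor
  guarded α zero = complement (decode β 0)
  guarded α (suc _) = α

  cover : Point → Cantor
  cover (low α) = encode (guarded α)
  cover (mid δ) = δ
  cover (high _) = complement β

  ∈ᶜ-cover : ∀ α → α ∈ᶜ cover (low α)
  ∈ᶜ-cover α = ∈ᶜ-encode (guarded α) 1

  β≗cover⇒≈mid : ∀ x → β ≗ᶜ cover x → mid β ≈ᵖ x
  β≗cover⇒≈mid (low α) β≗cover =
    ⊥-elim (≗ᶜ-complement-absurd
      (≗ᶜ-trans (decode-cong β≗cover 0) (decode-encode (guarded α) 0)))
  β≗cover⇒≈mid (mid δ) β≗δ = mid β≗δ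
  β≗cover⇒≈mid (high _) β≗β̄ = ⊥-elim (≗ᶜ-complement-absurd β≗β̄)

  covers : List Point → ℕ → Cantor
  covers Q = pad (complement β) (map cover Q)

  covering : List Point → Cantor
  covering Q = encode (covers Q)

  cover-∈ᶜ-covering : ∀ {Q x} → x ∈ Q → cover x ∈ᶜ covering Q
  cover-∈ᶜ-covering {Q} x∈Q =
    let n , padₙ≡cover = pad-complete (complement β) (∈-map⁺ cover x∈Q)
    in subst (_∈ᶜ covering Q) padₙ≡cover (∈ᶜ-encode (covers Q) n)

  β≗covers⇒≈mid : ∀ Q n → β ≗ᶜ covers Q n → ∃[ x ] (x ∈ Q × mid β ≈ᵖ x)
  β≗covers⇒≈mid Q n β≗coversₙ with pad-sound (complement β) (map cover Q) n
  ... | inj₁ coversₙ≡β̄ = ⊥-elim (≗ᶜ-complement-absurd (subst (β ≗ᶜ_) coversₙ≡β̄ β≗coversₙ))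
  ... | inj₂ coversₙ∈ with ∈-map⁻ cover coversₙ∈
  ...   | x , x∈Q , coversₙ≡cover =
    x , x∈Q , β≗cover⇒≈mid x (subst (β ≗ᶜ_) coversₙ≡cover β≗coversₙ)

  mid≤covering⇒≈mid : ∀ {Q} → mid β ≤ᵖ high (covering Q) → ∃[ x ] (x ∈ Q × mid β ≈ᵖ x)
  mid≤covering⇒≈mid {Q} (inj₂ (mid⋖high (n , β≗entry))) =
    β≗covers⇒≈mid Q n (≗ᶜ-trans β≗entry (decode-encode (covers Q) n))

separate : ∀ (Q : List Point) → All (λ x → Level1 x ⊎ Level2 x) Q →
           ∀ q → Level2 q → All (λ x → ¬ (q ≈ᵖ x)) Q →
           ∃[ r ] (Level3 r × All (λ x → x ≤ᵖ r) Q × ¬ (q ≤ᵖ r))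
separate Q _ (low _) q-level2 _ = ⊥-elim (¬Level2-low q-level2)
separate Q _ (high _) q-level2 _ = ⊥-elim (¬Level2-high q-level2)
separate Q Q-levels (mid β) _ q≉Q =
  high (covering Q) , Level3-high , All.tabulate below , q≰r
  where
  open Avoiding β

  below : ∀ {x} → x ∈ Q → x ≤ᵖ high (covering Q)
  below {low α} x∈Q = inj₂ (low⋖high (∈ᶜ-cover α) (cover-∈ᶜ-covering x∈Q))
  below {mid _} x∈Q = inj₂ (mid⋖high (cover-∈ᶜ-covering x∈Q))
  below {high _} x∈Q = ⊥-elim ([ ¬Level1-high , ¬Level2-high ] (All.lookup Q-levels x∈Q))

  q≰r : ¬ (mid β ≤ᵖ high (covering Q))
  q≰r mid≤r = let x , x∈Q , q≈x = mid≤covering⇒≈mid mid≤r in All.lookup q≉Q x∈Q q≈x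

lemma3p2 : Σ (Poset 0ℓ 0ℓ 0ℓ) (λ P → PosetNotions.Lemma3p2Props P)
lemma3p2 =
  P ,
  (locally-countable , continuum , height-three) ,
  Level1-continuum ,
  countable-upper-bound ,
  separate
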